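{- Let $n \ge 4$ be an integer with $C(n) = 1$. Then $\sigma_\infty(2n-2) = \sigma_\infty(2n-1)$.
   Context: $T:\mathbb{Z}^+\to\mathbb{Z}^+$ is defined by $T(x) = x/2$ if $x$ is even and $T(x) = (3x+1)/2$ if $x$ is odd; $T^k$ denotes the $k$-fold iterate, $T^0$ the identity. For $x \in \mathbb{Z}^+$, the total stopping time $\sigma_\infty(x)$ is the least $k \ge 0$ with $T^k(x) = 1$, and $\sigma_\infty(x) = \infty$ if no such $k$ exists. The function $C:\mathbb{Z}^+\to\{0,1\}$ is defined recursively by $C(1) = 0$, $C(n) = 1 - C(n-2)$ if $n > 1$ is odd, and $C(n) = 1 - C(n/2)$ if $n$ is even. -}

module Defs where

open import Data.Nat using (ℕ; zero; suc; _+_; _*_; _∸_; _<_; _/_; _%_)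
open import Data.Bool using (Bool; true; false; if_then_else_)
open import Data.Product using (_×_)
open import Relation.Binary.PropositionalEquality using (_≡_; _≢_)

even? : ℕ → Bool
even? zero = true
even? (suc zero) = false
even? (suc (suc n)) = even? n

T : ℕ → ℕ
T x = if even? x then x / 2 else (3 * x + 1) / 2

T^ : ℕ → ℕ → ℕ
T^ zero x = x
T^ (suc k) x = T (T^ k x)

-- σ∞(x) = k : k is the least k ≥ 0 with T^k(x) = 1
-- (σ∞(x) = ∞ iff there is no k with StopsAt x k)
StopsAt : ℕ → ℕ → Set
StopsAt x k = (T^ k x ≡ 1) × (∀ j → j < k → T^ j x ≢ 1)

-- Each recursive call strictly decreases n (for n ≥ 1), so fuel n suffices.
-- Value at 0 is an arbitrary convention (C is only defined on ℤ⁺).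
Cf : ℕ → ℕ → ℕ
Cf zero n = 0
Cf (suc f) zero = 0
Cf (suc f) (suc zero) = 0
Cf (suc f) (suc (suc m)) =
  if even? m then 1 ∸ Cf f ((suc (suc m)) / 2) else 1 ∸ Cf f m

C : ℕ → ℕ
C n = Cf n n

{-# OPTIONS --safe #-}
module Submission where

-- Write n = 2^a (2k + 1).  Unfolding its recursion, C n is the parity of a + k.  One step of T
-- sends 2n − 2 and 2n − 1 to n − 1 and 3n − 1, and these two orbits coalesce before reaching 1:
-- if a = 0, then k is odd and both reach (3n − 1)/4 after two more steps; if a > 0, one step
-- sends them to m − 1 and 3m − 1 with m = 3n/2 = 2^(a−1) (2(3k + 1) + 1), which keeps a + k odd.
-- The bound n ≥ 4 keeps every value visited before the orbits meet away from 1.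

open import Defs
open import Data.Nat using (ℕ; zero; suc; _+_; _*_; _∸_; _^_; _/_; _≤_; _<_; z≤n; s≤s; s≤s⁻¹; NonZero; parity)
open import Data.Nat.Properties using (*-suc; *-comm; *-assoc; *-identityˡ; suc-injective; m≤m+n; n≤1+n; ≤-refl; ≤-trans; m^n≢0; m*n≢0)
open import Data.Nat.DivMod using (m*n/n≡m; m/n<m)
open import Data.Nat.Induction using (<-rec)
open import Data.Nat.Tactic.RingSolver using (solve-∀)
open import Data.Parity.Base as ℙ using (Parity; 0ℙ; 1ℙ)
open import Data.Parity.Properties using (+-homo-+; *-homo-*; +-identityʳ)
open import Data.Bool using (true; false)
open import Data.Product using (∃-syntax; ∃₂; _×_; _,_)
open import Data.Sum using (_⊎_; inj₁; inj₂)
open import Data.Empty using (⊥-elim)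
open import Relation.Binary.PropositionalEquality
  using (_≡_; _≢_; refl; sym; trans; cong; subst₂; module ≡-Reasoning)
open import Function.Base using (_∘_)
open import Function.Bundles using (_⇔_; mk⇔)

open ≡-Reasoning

even?-double : ∀ k → even? (2 * k) ≡ true
even?-double zero = refl
even?-double (suc k) = trans (cong even? (*-suc 2 k)) (even?-double k)

even?-suc-double : ∀ k → even? (suc (2 * k)) ≡ false
even?-suc-double zero = refl
even?-suc-double (suc k) = trans (cong (even? ∘ suc) (*-suc 2 k)) (even?-suc-double k)

double≢1 : ∀ k → 2 * k ≢ 1
double≢1 k 2k≡1 with trans (sym (even?-double k)) (cong even? 2k≡1)
... | ()

double/2 : ∀ k → 2 * k / 2 ≡ k
double/2 k rewrite *-comm 2 k = m*n/n≡m k 2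

T-double : ∀ k → T (2 * k) ≡ k
T-double k rewrite even?-double k = double/2 k

T-suc-double : ∀ k → T (suc (2 * k)) ≡ 2 + 3 * k
T-suc-double k rewrite even?-suc-double k = begin
  (3 * suc (2 * k) + 1) / 2 ≡⟨ cong (_/ 2) (3[1+2k]+1≡2[2+3k] k) ⟩
  2 * (2 + 3 * k) / 2       ≡⟨ double/2 (2 + 3 * k) ⟩
  2 + 3 * k                 ∎
  where
  3[1+2k]+1≡2[2+3k] : ∀ k → 3 * suc (2 * k) + 1 ≡ 2 * (2 + 3 * k)
  3[1+2k]+1≡2[2+3k] = solve-∀

T^-T : ∀ k x → T^ k (T x) ≡ T^ (suc k) x
T^-T zero x = refl
T^-T (suc k) x = cong T (T^-T k x)

stopsAt-suc⇒T : ∀ {x k} → StopsAt x (suc k) → StopsAt (T x) k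
stopsAt-suc⇒T {x} {k} (reaches , avoids) =
  trans (T^-T k x) reaches ,
  λ j j<k Tʲ⁺¹x≡1 → avoids (suc j) (s≤s j<k) (trans (sym (T^-T j x)) Tʲ⁺¹x≡1)

T⇒stopsAt-suc : ∀ {x k} → x ≢ 1 → StopsAt (T x) k → StopsAt x (suc k)
T⇒stopsAt-suc {x} {k} x≢1 (reaches , avoids) = trans (sym (T^-T k x)) reaches , avoids′
  where
  avoids′ : ∀ j → j < suc k → T^ j x ≢ 1
  avoids′ zero _ = x≢1
  avoids′ (suc j) (s≤s j<k) Tʲ⁺¹x≡1 = avoids j j<k (trans (T^-T j x) Tʲ⁺¹x≡1)

data Coalesce : ℕ → ℕ → Set where
  same : ∀ {x} → Coalesce x x
  step : ∀ {x y} → x ≢ 1 → y ≢ 1 → Coalesce (T x) (T y) → Coalesce x y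

coalesce-step : ∀ {x y x′ y′} → T x ≡ x′ → T y ≡ y′ →
                x ≢ 1 → y ≢ 1 → Coalesce x′ y′ → Coalesce x y
coalesce-step refl refl = step

coalesce-sym : ∀ {x y} → Coalesce x y → Coalesce y x
coalesce-sym same = same
coalesce-sym (step x≢1 y≢1 c) = step y≢1 x≢1 (coalesce-sym c)

coalesce-stopsAt : ∀ {x y k} → Coalesce x y → StopsAt x k → StopsAt y k
coalesce-stopsAt same s = s
coalesce-stopsAt {k = zero} (step x≢1 _ _) (x≡1 , _) = ⊥-elim (x≢1 x≡1)
coalesce-stopsAt {k = suc k} (step _ y≢1 c) s =
  T⇒stopsAt-suc y≢1 (coalesce-stopsAt c (stopsAt-suc⇒T s))

coalesce⇒stopsAt⇔ : ∀ {x y} → Coalesce x y → ∀ k → StopsAt x k ⇔ StopsAt y k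
coalesce⇒stopsAt⇔ c k = mk⇔ (coalesce-stopsAt c) (coalesce-stopsAt (coalesce-sym c))

even-or-odd : ∀ n → ∃[ k ] (n ≡ 2 * k ⊎ n ≡ suc (2 * k))
even-or-odd zero = 0 , inj₁ refl
even-or-odd (suc n) with even-or-odd n
... | k , inj₁ refl = k , inj₂ refl
... | k , inj₂ refl = suc k , inj₁ (sym (*-suc 2 k))

suc≡double⇒odd : ∀ {x} w → suc x ≡ 2 * w → ∃[ t ] (w ≡ suc t × x ≡ suc (2 * t))
suc≡double⇒odd (suc t) x+1≡2w = t , refl , suc-injective (trans x+1≡2w (*-suc 2 t))

pow2*odd : ∀ m → ∃₂ λ a k → suc m ≡ 2 ^ a * suc (2 * k)
pow2*odd = <-rec _ decompose
  where
  decompose : ∀ m → (∀ {m′} → m′ < m → ∃₂ λ a k → suc m′ ≡ 2 ^ a * suc (2 * k)) →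
              ∃₂ λ a k → suc m ≡ 2 ^ a * suc (2 * k)
  decompose m rec with even-or-odd m
  ... | k , inj₁ refl = 0 , k , sym (*-identityˡ _)
  ... | w , inj₂ refl with rec (s≤s (m≤m+n w (w + 0)))
  ...   | a , k , w+1≡ = suc a , k , (begin
    2 + 2 * w                ≡⟨ sym (*-suc 2 w) ⟩
    2 * suc w                ≡⟨ cong (2 *_) w+1≡ ⟩
    2 * (2 ^ a * suc (2 * k)) ≡⟨ sym (*-assoc 2 (2 ^ a) _) ⟩
    2 ^ suc a * suc (2 * k)  ∎)

parity-+-double : ∀ n k → parity (n + 2 * k) ≡ parity n
parity-+-double n k = begin
  parity (n + 2 * k)          ≡⟨ +-homo-+ n (2 * k) ⟩
  parity n ℙ.+ parity (2 * k) ≡⟨ cong (parity n ℙ.+_) (*-homo-* 2 k) ⟩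
  parity n ℙ.+ 0ℙ             ≡⟨ +-identityʳ (parity n) ⟩
  parity n                    ∎

parity≡1ℙ⇒odd : ∀ k → parity k ≡ 1ℙ → ∃[ j ] k ≡ suc (2 * j)
parity≡1ℙ⇒odd k odd with even-or-odd k
... | j , inj₁ refl with trans (sym (*-homo-* 2 j)) odd
...   | ()
parity≡1ℙ⇒odd k odd | j , inj₂ refl = j , refl

toℕ : Parity → ℕ
toℕ 0ℙ = 0
toℕ 1ℙ = 1

toℕ-injective : ∀ {p q} → toℕ p ≡ toℕ q → p ≡ q
toℕ-injective {0ℙ} {0ℙ} _ = refl
toℕ-injective {1ℙ} {1ℙ} _ = refl

toℕ-parity-suc : ∀ n → toℕ (parity (suc n)) ≡ 1 ∸ toℕ (parity n)
toℕ-parity-suc zero = refl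
toℕ-parity-suc (suc zero) = refl
toℕ-parity-suc (suc (suc n)) = toℕ-parity-suc n

half≤ : ∀ m → suc (suc m) / 2 ≤ suc m
half≤ m = s≤s⁻¹ (m/n<m (suc (suc m)) 2 (s≤s (s≤s z≤n)))

Cf-stable : ∀ {f g n} → n ≤ f → n ≤ g → Cf f n ≡ Cf g n
Cf-stable {zero} {zero} {zero} _ _ = refl
Cf-stable {zero} {suc g} {zero} _ _ = refl
Cf-stable {suc f} {zero} {zero} _ _ = refl
Cf-stable {suc f} {suc g} {zero} _ _ = refl
Cf-stable {suc f} {suc g} {suc zero} _ _ = refl
Cf-stable {suc f} {suc g} {suc (suc m)} (s≤s m+1≤f) (s≤s m+1≤g) with even? m
... | true = cong (1 ∸_) (Cf-stable (≤-trans (half≤ m) m+1≤f) (≤-trans (half≤ m) m+1≤g))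
... | false = cong (1 ∸_) (Cf-stable (≤-trans (n≤1+n m) m+1≤f) (≤-trans (n≤1+n m) m+1≤g))

C-2+even : ∀ m → even? m ≡ true → C (2 + m) ≡ 1 ∸ C ((2 + m) / 2)
C-2+even m m-even rewrite m-even = cong (1 ∸_) (Cf-stable (half≤ m) ≤-refl)

C-2+odd : ∀ m → even? m ≡ false → C (2 + m) ≡ 1 ∸ C m
C-2+odd m m-odd rewrite m-odd = cong (1 ∸_) (Cf-stable (n≤1+n m) ≤-refl)

C-suc-double : ∀ k → C (suc (2 * k)) ≡ toℕ (parity k)
C-suc-double zero = refl
C-suc-double (suc k) = begin
  C (suc (2 * suc k))  ≡⟨ cong (C ∘ suc) (*-suc 2 k) ⟩
  C (2 + suc (2 * k))  ≡⟨ C-2+odd (suc (2 * k)) (even?-suc-double k) ⟩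
  1 ∸ C (suc (2 * k))  ≡⟨ cong (1 ∸_) (C-suc-double k) ⟩
  1 ∸ toℕ (parity k)   ≡⟨ sym (toℕ-parity-suc k) ⟩
  toℕ (parity (suc k)) ∎

C-double : ∀ m .{{_ : NonZero m}} → C (2 * m) ≡ 1 ∸ C m
C-double (suc w) = begin
  C (2 * suc w)             ≡⟨ cong C (*-suc 2 w) ⟩
  C (2 + 2 * w)             ≡⟨ C-2+even (2 * w) (even?-double w) ⟩
  1 ∸ C ((2 + 2 * w) / 2)   ≡⟨ cong (λ h → 1 ∸ C h) (sym (cong (_/ 2) (*-suc 2 w))) ⟩
  1 ∸ C (2 * suc w / 2)     ≡⟨ cong (λ h → 1 ∸ C h) (double/2 (suc w)) ⟩
  1 ∸ C (suc w)             ∎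

C-pow2*odd : ∀ a k → C (2 ^ a * suc (2 * k)) ≡ toℕ (parity (a + k))
C-pow2*odd zero k = trans (cong C (*-identityˡ (suc (2 * k)))) (C-suc-double k)
C-pow2*odd (suc a) k = begin
  C (2 ^ suc a * o)          ≡⟨ cong C (*-assoc 2 (2 ^ a) o) ⟩
  C (2 * (2 ^ a * o))        ≡⟨ C-double (2 ^ a * o) {{m*n≢0 (2 ^ a) o {{m^n≢0 2 a}}}} ⟩
  1 ∸ C (2 ^ a * o)          ≡⟨ cong (1 ∸_) (C-pow2*odd a k) ⟩
  1 ∸ toℕ (parity (a + k))   ≡⟨ sym (toℕ-parity-suc (a + k)) ⟩
  toℕ (parity (suc a + k))   ∎
  where
  o : ℕ
  o = suc (2 * k)

coalesce-3x+2-base : ∀ j → let x = 2 * suc (2 * j) in 3 ≤ x → Coalesce x (2 + 3 * x)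
coalesce-3x+2-base zero (s≤s (s≤s ()))
coalesce-3x+2-base (suc i) _ =
  coalesce-step (T-double u) Ty≡ (double≢1 u) (λ ())
    (coalesce-step (T-suc-double (suc i)) TTy≡ (λ ()) (λ ()) same)
  where
  u : ℕ
  u = suc (2 * suc i)
  Ty≡ : T (2 + 3 * (2 * u)) ≡ suc (3 * u)
  Ty≡ = trans (cong T (2+6u≡2[1+3u] i)) (T-double (suc (3 * u)))
    where
    2+6u≡2[1+3u] : ∀ i → 2 + 3 * (2 * suc (2 * suc i)) ≡ 2 * suc (3 * suc (2 * suc i))
    2+6u≡2[1+3u] = solve-∀
  TTy≡ : T (suc (3 * u)) ≡ 2 + 3 * suc i
  TTy≡ = trans (cong T (1+3u≡2[2+3j] i)) (T-double (2 + 3 * suc i))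
    where
    1+3u≡2[2+3j] : ∀ i → suc (3 * suc (2 * suc i)) ≡ 2 * (2 + 3 * suc i)
    1+3u≡2[2+3j] = solve-∀

coalesce-3x+2-step : ∀ t → 1 ≤ t → Coalesce (2 + 3 * t) (2 + 3 * (2 + 3 * t)) →
                     let x = suc (2 * t) in Coalesce x (2 + 3 * x)
coalesce-3x+2-step t@(suc _) _ =
  coalesce-step (T-suc-double t) Ty≡ (λ ()) (λ ())
  where
  Ty≡ : T (2 + 3 * suc (2 * t)) ≡ 2 + 3 * (2 + 3 * t)
  Ty≡ = trans (cong T (5+6t≡1+2[2+3t] t)) (T-suc-double (2 + 3 * t))
    where
    5+6t≡1+2[2+3t] : ∀ t → 2 + 3 * suc (2 * t) ≡ suc (2 * (2 + 3 * t))
    5+6t≡1+2[2+3t] = solve-∀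

coalesce-3x+2 : ∀ a k x → suc x ≡ 2 ^ a * suc (2 * k) → parity (a + k) ≡ 1ℙ → 3 ≤ x →
                Coalesce x (2 + 3 * x)
coalesce-3x+2 zero k x x+1≡ a+k-odd 3≤x with parity≡1ℙ⇒odd k a+k-odd
... | j , refl with suc-injective (trans x+1≡ (*-identityˡ _))
...   | refl = coalesce-3x+2-base j 3≤x
coalesce-3x+2 (suc a) k x x+1≡ a+k-odd 3≤x
  with suc≡double⇒odd (2 ^ a * suc (2 * k)) (trans x+1≡ (*-assoc 2 (2 ^ a) (suc (2 * k))))
... | zero , _ , refl with 3≤x
...   | s≤s ()
coalesce-3x+2 (suc a) k x x+1≡ a+k-odd 3≤x | t@(suc _) , w≡ , refl =
  coalesce-3x+2-step t (s≤s z≤n)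
    (coalesce-3x+2 a (suc (3 * k)) (2 + 3 * t) x′+1≡ (trans parity≡ a+k-odd) (s≤s (s≤s (s≤s z≤n))))
  where
  x′+1≡ : 3 + 3 * t ≡ 2 ^ a * suc (2 * suc (3 * k))
  x′+1≡ = begin
    3 + 3 * t                      ≡⟨ *-suc 3 t ⟨
    3 * suc t                      ≡⟨ cong (3 *_) w≡ ⟨
    3 * (2 ^ a * suc (2 * k))      ≡⟨ triple-odd (2 ^ a) k ⟩
    2 ^ a * suc (2 * suc (3 * k))  ∎
    where
    triple-odd : ∀ p k → 3 * (p * suc (2 * k)) ≡ p * suc (2 * suc (3 * k))
    triple-odd = solve-∀
  parity≡ : parity (a + suc (3 * k)) ≡ parity (suc a + k)
  parity≡ = trans (cong parity (regroup a k)) (parity-+-double (suc a + k) k)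
    where
    regroup : ∀ a k → a + suc (3 * k) ≡ suc a + k + 2 * k
    regroup = solve-∀

coalesce-double : ∀ x → 1 ≤ x → Coalesce x (2 + 3 * x) → Coalesce (2 * x) (suc (2 * x))
coalesce-double x@(suc _) _ =
  coalesce-step (T-double x) (T-suc-double x) (double≢1 x) (λ ())

corollary4p3 : (n : ℕ) → 4 ≤ n → C n ≡ 1 →
    (k : ℕ) → StopsAt (2 * n ∸ 2) k ⇔ StopsAt (2 * n ∸ 1) k
corollary4p3 (suc x) 4≤n Cn≡1 k with pow2*odd x
... | a , j , n≡ =
  subst₂ (λ u v → StopsAt u k ⇔ StopsAt v k) (cong (_∸ 2) 2+2x≡2n) (cong (_∸ 1) 2+2x≡2n)
    (coalesce⇒stopsAt⇔ (coalesce-double x 1≤x (coalesce-3x+2 a j x n≡ a+j-odd 3≤x)) k)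
  where
  3≤x : 3 ≤ x
  3≤x = s≤s⁻¹ 4≤n
  1≤x : 1 ≤ x
  1≤x = ≤-trans (s≤s z≤n) 3≤x
  2+2x≡2n : 2 + 2 * x ≡ 2 * suc x
  2+2x≡2n = sym (*-suc 2 x)
  a+j-odd : parity (a + j) ≡ 1ℙ
  a+j-odd = toℕ-injective (begin
    toℕ (parity (a + j))      ≡⟨ C-pow2*odd a j ⟨
    C (2 ^ a * suc (2 * j))   ≡⟨ cong C n≡ ⟨
    C (suc x)                 ≡⟨ Cn≡1 ⟩
    1                         ∎)
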